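{- Let $H$ be a finite connected graph. Then the signature system of $H$ admits an integer solution if and only if there exist an odd cycle $C$ and a homomorphism $f:C\to H$ such that $\sigma_{\mathcal{G}(H)}(f)=0_{\mathcal{G}(H)}$.
   Context: $A(H)$ is the set of arcs of $H$ (each edge $[u,v]$ gives arcs $(u,v),(v,u)$). $\mathcal{G}(H)=\mathbb{Z}^{A(H)}/\theta$, where $\theta$ is the subgroup generated by $(u,v)-(w,v)+(w,x)-(u,x)$ over all 4-cycles $u,v,w,x$ of $H$. The signature system of $H$ has an integer variable $X_{u,v}$ for each arc $(u,v)\in A(H)$ and an integer variable $N$, and consists of: the flow constraint $\sum_{v\in N_H(u)}(X_{u,v}-X_{v,u})=0$ at every vertex $u$; the parity constraint $\sum_{(u,v)\in A(H)}X_{u,v}-2N=1$; and the signature constraint that $\sum_{(u,v)\in A(H)}(X_{u,v}-X_{v,u})\cdot(u,v)$ lies in $\theta$ (i.e. is $0$ in $\mathcal{G}(H)$). The exponential graph $H^C$ has vertices all functions $V(C)\to V(H)$ and edges $[f,g]$ with $[f(u),g(v)]\in E(H)$ for all edges $[u,v]$ of $C$ (so a homomorphism $f$ is a loop of $H^C$). With $V(C)=\mathbb{Z}_{2n+1}$, for a non-isolated $f$ in $H^C$, $\sigma_{\mathcal{G}(H)}(f)$ is the class mod $\theta$ of $\sum_{i=0}^{2n}[(f(2i),g(2i+1))-(f(2i+2),g(2i+1))]$ for any neighbour $g$ of $f$ (independent of $g$). -}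

module Defs where

open import Data.Nat as ℕ using (ℕ; zero; suc; _≥_)
open import Data.Nat.DivMod using (_mod_)
open import Data.Integer as ℤ using (ℤ; +_; _+_; _-_; _*_)
open import Data.Fin using (Fin; toℕ; _≟_)
open import Data.Bool using (Bool; true; false; _∧_; if_then_else_)
open import Data.Product using (Σ; ∃; _×_; _,_)
open import Relation.Nullary using (¬_)
open import Relation.Nullary.Decidable using (⌊_⌋)
open import Relation.Binary.PropositionalEquality using (_≡_)

sumℕ : ℕ → (ℕ → ℤ) → ℤ
sumℕ zero    f = + 0
sumℕ (suc k) f = sumℕ k f + f k

sumFin : (n : ℕ) → (Fin n → ℤ) → ℤ
sumFin zero    f = + 0
sumFin (suc n) f = f Fin.zero + sumFin n (λ i → f (Fin.suc i))
  where import Data.Fin as Fin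

[_] : Bool → ℤ
[ b ] = if b then + 1 else + 0

_==_ : ∀ {n} → Fin n → Fin n → Bool
a == b = ⌊ a ≟ b ⌋

record Graph (n : ℕ) : Set where
  field
    adj   : Fin n → Fin n → Bool
    sym   : ∀ u v → adj u v ≡ true → adj v u ≡ true
    irrfl : ∀ u → adj u u ≡ false

open Graph public

data Walk {n} (H : Graph n) : Fin n → Fin n → Set where
  here : ∀ {u} → Walk H u u
  step : ∀ {u w v} → adj H u w ≡ true → Walk H w v → Walk H u v

Connected : ∀ {n} → Graph n → Set
Connected {n} H = (u v : Fin n) → Walk H u v

-- Z^{A(H)}: integer vectors indexed by pairs; only arcs (u,v) (adj u v ≡ true)
-- are coordinates of Z^{A(H)}.

ArcVec : ℕ → Set
ArcVec n = Fin n → Fin n → ℤ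

Is4Cycle : ∀ {n} → Graph n → Fin n → Fin n → Fin n → Fin n → Set
Is4Cycle H u v w x =
  (adj H u v ≡ true) × (adj H v w ≡ true) × (adj H w x ≡ true) ×
  (adj H x u ≡ true) × (¬ u ≡ w) × (¬ v ≡ x)

gen : ∀ {n} → Fin n → Fin n → Fin n → Fin n → ArcVec n
gen u v w x a b =
  [ (a == u) ∧ (b == v) ] - [ (a == w) ∧ (b == v) ]
  + [ (a == w) ∧ (b == x) ] - [ (a == u) ∧ (b == x) ]

InTheta : ∀ {n} → Graph n → ArcVec n → Set
InTheta {n} H z =
  Σ (Fin n → Fin n → Fin n → Fin n → ℤ) λ c →
    (∀ u v w x → ¬ Is4Cycle H u v w x → c u v w x ≡ + 0) ×
    (∀ a b → adj H a b ≡ true →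
       z a b ≡ sumFin n λ u → sumFin n λ v → sumFin n λ w → sumFin n λ x →
                 c u v w x * gen u v w x a b)

-- X is indexed by all pairs, but only the values on arcs enter the system
SignatureSolution : ∀ {n} → Graph n → (Fin n → Fin n → ℤ) → ℤ → Set
SignatureSolution {n} H X N =
  (∀ u → sumFin n (λ v → [ adj H u v ] * (X u v - X v u)) ≡ + 0) ×
  ((sumFin n λ u → sumFin n λ v → [ adj H u v ] * X u v) - (+ 2) * N ≡ + 1) ×
  InTheta H (λ u v → X u v - X v u)

SignatureSystemSolvable : ∀ {n} → Graph n → Set
SignatureSystemSolvable {n} H =
  Σ (Fin n → Fin n → ℤ) λ X → Σ ℤ λ N → SignatureSolution H X N

at : ∀ {n} (L : ℕ) .{{_ : ℕ.NonZero L}} → (Fin L → Fin n) → ℕ → Fin n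
at L f k = f (k mod L)

IsHom : ∀ {n} → Graph n → (m : ℕ) → (Fin (suc (2 ℕ.* m)) → Fin n) → Set
IsHom H m f = ∀ (i : Fin (suc (2 ℕ.* m))) →
  adj H (f i) (at (suc (2 ℕ.* m)) f (suc (toℕ i))) ≡ true

sigmaVec : ∀ {n} (m : ℕ) → (f g : Fin (suc (2 ℕ.* m)) → Fin n) → ArcVec n
sigmaVec m f g a b =
  sumℕ L λ i →
    [ (a == at L f (2 ℕ.* i)) ∧ (b == at L g (suc (2 ℕ.* i))) ]
    - [ (a == at L f (suc (suc (2 ℕ.* i)))) ∧ (b == at L g (suc (2 ℕ.* i))) ]
  where L = suc (2 ℕ.* m)

-- σ_{G(H)}(f) = 0 for a homomorphism f (a loop of H^C, so f is its own
-- neighbour and we may take g = f in the definition of σ)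
SigmaZero : ∀ {n} → Graph n → (m : ℕ) → (Fin (suc (2 ℕ.* m)) → Fin n) → Set
SigmaZero H m f = InTheta H (sigmaVec m f f)

-- Read the unknowns X as integer arc multiplicities. A homomorphism f from the cycle of length
-- 2m+1 is a closed walk of odd length, and σ(f) is the antisymmetric part X - Xᵀ of its arc
-- counts X: with g = f, the i-th term of σ counts step 2i forwards and step 2i+1 backwards, and
-- modulo 2m+1 the map i ↦ 2i is a bijection. These counts are balanced at every vertex and total
-- 2m+1, so they solve the signature system with N = m.
--
-- Conversely, add a large symmetric even matrix to a solution X, which makes it non-negative without
-- changing X - Xᵀ or the parity of the total. Fix a root r and walks P u from r to every vertex u,
-- and traverse each arc (u,v) X(u,v) times, each time on the loop P u, (u,v), reverse (P v). Since X
-- is balanced, every P u is walked as often forwards as backwards, so the concatenated closed walk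
-- has antisymmetric arc count X - Xᵀ, and its length is the total of X plus an even number, hence
-- odd. Read as a map from an odd cycle, this walk is a homomorphism with σ = 0.

module Submission where

open import Defs renaming (sym to adj-sym)
open import Data.Bool using (true; false; _∧_)
import Data.Bool.Properties as BoolP
open import Data.Fin as F using (Fin; toℕ; _≟_)
import Data.Fin.Properties as FP
open import Data.Integer using (ℤ; +_; -[1+_]; _+_; _-_; _*_; -_; ∣_∣)
import Data.Integer.Properties as ℤP
open import Data.Integer.Tactic.RingSolver using (solve-∀)
open import Data.Nat as ℕ using (ℕ; zero; suc; _≥_; z≤n; s≤s)
open import Data.Nat.DivMod using (_mod_; _%_)
import Data.Nat.DivMod as DM
import Data.Nat.Properties as ℕP
import Data.Nat.Tactic.RingSolver as NS
open import Data.Product using (Σ; _×_; _,_; proj₁; proj₂)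
open import Data.Sum using (_⊎_; inj₁; inj₂)
open import Function using (_∘_; _⇔_; mk⇔)
open import Relation.Binary.PropositionalEquality hiding ([_])
open import Relation.Nullary using (yes; no; contradiction)
open import Algebra.Properties.AbelianGroup ℤP.+-0-abelianGroup
  using (⁻¹-anti-homo‿-) renaming (∙-cancelˡ to +-cancelˡ)
open import Algebra.Properties.Semiring.Sum ℤP.+-*-semiring
  using (sum-syntax; sum-cong-≗; ∑-distrib-+; ∑-comm; sum-replicate-zero; *-distribˡ-sum; *-distribʳ-sum)

sumFin≡∑ : ∀ n (f : Fin n → ℤ) → sumFin n f ≡ ∑[ i < n ] f i
sumFin≡∑ zero    f = refl
sumFin≡∑ (suc n) f = cong (_+_ (f F.zero)) (sumFin≡∑ n (f ∘ F.suc))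

sumFin²≡∑∑ : ∀ n (f : Fin n → Fin n → ℤ) →
  sumFin n (λ u → sumFin n (f u)) ≡ ∑[ u < n ] ∑[ v < n ] f u v
sumFin²≡∑∑ n f = trans (sumFin≡∑ n _) (sum-cong-≗ (λ u → sumFin≡∑ n (f u)))

∑-neg : ∀ {n} (f : Fin n → ℤ) → ∑[ i < n ] (- f i) ≡ - ∑[ i < n ] f i
∑-neg {zero}  f = refl
∑-neg {suc n} f = trans (cong (_+_ (- f F.zero)) (∑-neg (f ∘ F.suc)))
  (sym (ℤP.neg-distrib-+ (f F.zero) (∑[ i < n ] f (F.suc i))))

∑-distrib-- : ∀ {n} (f g : Fin n → ℤ) → ∑[ i < n ] (f i - g i) ≡ ∑[ i < n ] f i - ∑[ i < n ] g i
∑-distrib-- f g = trans (∑-distrib-+ f (λ i → - g i)) (cong (_+_ (∑[ i < _ ] f i)) (∑-neg g))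

∑∑-distrib₃ : ∀ {n} (f g h : Fin n → Fin n → ℤ) →
  ∑[ u < n ] ∑[ v < n ] (f u v + g u v + h u v) ≡
  ∑[ u < n ] ∑[ v < n ] f u v + ∑[ u < n ] ∑[ v < n ] g u v + ∑[ u < n ] ∑[ v < n ] h u v
∑∑-distrib₃ {n} f g h = begin
  ∑[ u < n ] ∑[ v < n ] (f u v + g u v + h u v)
    ≡⟨ sum-cong-≗ (λ u → trans (∑-distrib-+ (λ v → f u v + g u v) (h u))
                               (cong (_+ ∑[ v < n ] h u v) (∑-distrib-+ (f u) (g u)))) ⟩
  ∑[ u < n ] (∑[ v < n ] f u v + ∑[ v < n ] g u v + ∑[ v < n ] h u v)
    ≡⟨ ∑-distrib-+ (λ u → ∑[ v < n ] f u v + ∑[ v < n ] g u v) (λ u → ∑[ v < n ] h u v) ⟩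
  ∑[ u < n ] (∑[ v < n ] f u v + ∑[ v < n ] g u v) + ∑[ u < n ] ∑[ v < n ] h u v
    ≡⟨ cong (_+ ∑[ u < n ] ∑[ v < n ] h u v)
            (∑-distrib-+ (λ u → ∑[ v < n ] f u v) (λ u → ∑[ v < n ] g u v)) ⟩
  ∑[ u < n ] ∑[ v < n ] f u v + ∑[ u < n ] ∑[ v < n ] g u v + ∑[ u < n ] ∑[ v < n ] h u v ∎
  where open ≡-Reasoning

+∣i+s∣≡i+s : ∀ i s → ∣ i ∣ ℕ.≤ s → + ∣ i + + s ∣ ≡ i + + s
+∣i+s∣≡i+s (+ _)    s _      = refl
+∣i+s∣≡i+s -[1+ _ ] s ∣i∣≤s rewrite ℤP.⊖-≥ ∣i∣≤s = refl

pos-suc-double : ∀ k → + suc (2 ℕ.* k) ≡ + 1 + + 2 * + k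
pos-suc-double k = trans (ℤP.pos-+ 1 (2 ℕ.* k)) (cong (_+_ (+ 1)) (ℤP.pos-* 2 k))

parity⇒odd : ∀ T N → T - + 2 * N ≡ + 1 → T ≡ + 1 + + 2 * N
parity⇒odd T N eq = trans (unshift T (+ 2 * N)) (cong (_+ + 2 * N) eq)
  where
  unshift : ∀ t d → t ≡ t - d + d
  unshift = solve-∀

odd⇒suc-double : ∀ l K → + l ≡ + 1 + + 2 * K → Σ ℕ λ m → l ≡ suc (2 ℕ.* m)
odd⇒suc-double l (+ k)    l≡1+2K = k , ℤP.+-injective (trans l≡1+2K (sym (pos-suc-double k)))
odd⇒suc-double l -[1+ k ] l≡1+2K =
  contradiction (ℤP.+-injective l+2[1+k]≡1) (ℕP.<⇒≢ 1<l+2[1+k] ∘ sym)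
  where
  cancel : ∀ K → + 1 + + 2 * (- K) + + 2 * K ≡ + 1
  cancel = solve-∀
  l+2[1+k]≡1 : + (l ℕ.+ 2 ℕ.* suc k) ≡ + 1
  l+2[1+k]≡1 = begin
    + (l ℕ.+ 2 ℕ.* suc k)   ≡⟨ ℤP.pos-+ l _ ⟩
    + l + + (2 ℕ.* suc k)   ≡⟨ cong (_+_ (+ l)) (ℤP.pos-* 2 (suc k)) ⟩
    + l + + 2 * + suc k     ≡⟨ cong (_+ + 2 * + suc k) l≡1+2K ⟩
    + 1 + + 2 * -[1+ k ] + + 2 * + suc k  ≡⟨ cancel (+ suc k) ⟩
    + 1                     ∎
    where open ≡-Reasoning
  1<l+2[1+k] : 1 ℕ.< l ℕ.+ 2 ℕ.* suc k
  1<l+2[1+k] = ℕP.≤-trans (ℕP.*-monoʳ-≤ 2 (s≤s z≤n)) (ℕP.m≤n+m _ l)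

[∧]≡[]*[] : ∀ x y → [ x ∧ y ] ≡ [ x ] * [ y ]
[∧]≡[]*[] true  true  = refl
[∧]≡[]*[] true  false = refl
[∧]≡[]*[] false y     = refl

==-sym : ∀ {n} (a b : Fin n) → (a == b) ≡ (b == a)
==-sym a b with a ≟ b | b ≟ a
... | yes _   | yes _   = refl
... | no  _   | no  _   = refl
... | yes a≡b | no  b≢a = contradiction (sym a≡b) b≢a
... | no  a≢b | yes b≡a = contradiction (sym b≡a) a≢b

==-suc : ∀ {n} (a b : Fin n) → (F.suc a == F.suc b) ≡ (a == b)
==-suc a b with a ≟ b
... | yes refl = refl
... | no  _    = refl

==⇒≡ : ∀ {n} {a b : Fin n} → (a == b) ≡ true → a ≡ b
==⇒≡ {a = a} {b} eq with a ≟ b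
... | yes a≡b = a≡b

δ : ∀ {n} → Fin n → Fin n → Fin n → Fin n → ℤ
δ a b x y = [ (a == x) ∧ (b == y) ]

δ-flip : ∀ {n} (a b x y : Fin n) → δ a b x y ≡ δ b a y x
δ-flip a b x y = cong [_] (BoolP.∧-comm (a == x) (b == y))

net : ∀ {n} → Fin n → Fin n → Fin n → Fin n → ℤ
net a b x y = δ a b x y - δ a b y x

net-flip : ∀ {n} (a b x y : Fin n) → net a b y x ≡ - net a b x y
net-flip a b x y = sym (⁻¹-anti-homo‿- (δ a b x y) (δ a b y x))

∑-δ : ∀ {n} (a : Fin n) (g : Fin n → ℤ) → ∑[ x < n ] ([ a == x ] * g x) ≡ g a
∑-δ {suc n} F.zero g =
  trans (cong₂ _+_ (ℤP.*-identityˡ (g F.zero)) (sum-replicate-zero n)) (ℤP.+-identityʳ (g F.zero))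
∑-δ {suc n} (F.suc a) g = begin
  + 0 + ∑[ x < n ] ([ F.suc a == F.suc x ] * g (F.suc x)) ≡⟨ ℤP.+-identityˡ _ ⟩
  ∑[ x < n ] ([ F.suc a == F.suc x ] * g (F.suc x))
    ≡⟨ sum-cong-≗ (λ x → cong (λ e → [ e ] * g (F.suc x)) (==-suc a x)) ⟩
  ∑[ x < n ] ([ a == x ] * g (F.suc x))                   ≡⟨ ∑-δ a (g ∘ F.suc) ⟩
  g (F.suc a)                                              ∎
  where open ≡-Reasoning

∑-δ-count : ∀ {n} (a : Fin n) → ∑[ x < n ] [ x == a ] ≡ + 1
∑-δ-count a = trans (sum-cong-≗ (λ x → trans (cong [_] (==-sym x a)) (sym (ℤP.*-identityʳ [ a == x ]))))
  (∑-δ a (λ _ → + 1))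

∑-δ-source : ∀ {n} (u x y : Fin n) → ∑[ v < n ] δ u v x y ≡ [ u == x ]
∑-δ-source u x y = trans (sum-cong-≗ reorder) (∑-δ y (λ _ → [ u == x ]))
  where
  reorder : ∀ v → δ u v x y ≡ [ y == v ] * [ u == x ]
  reorder v = trans ([∧]≡[]*[] (u == x) (v == y))
    (trans (ℤP.*-comm [ u == x ] [ v == y ]) (cong (λ e → [ e ] * [ u == x ]) (==-sym v y)))

∑-δ-target : ∀ {n} (u x y : Fin n) → ∑[ v < n ] δ v u x y ≡ [ u == y ]
∑-δ-target u x y = trans (sum-cong-≗ (λ v → δ-flip v u x y)) (∑-δ-source u y x)

∑∑-δ : ∀ {n} (a b : Fin n) (g : Fin n → Fin n → ℤ) →
  ∑[ x < n ] ∑[ y < n ] (g x y * δ a b x y) ≡ g a b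
∑∑-δ {n} a b g = begin
  ∑[ x < n ] ∑[ y < n ] (g x y * δ a b x y)       ≡⟨ sum-cong-≗ (λ x → sum-cong-≗ (factor x)) ⟩
  ∑[ x < n ] ∑[ y < n ] ([ a == x ] * ([ b == y ] * g x y))
    ≡⟨ sum-cong-≗ (λ x → sym (*-distribˡ-sum [ a == x ] (λ y → [ b == y ] * g x y))) ⟩
  ∑[ x < n ] ([ a == x ] * ∑[ y < n ] ([ b == y ] * g x y))
    ≡⟨ sum-cong-≗ (λ x → cong (_*_ [ a == x ]) (∑-δ b (g x))) ⟩
  ∑[ x < n ] ([ a == x ] * g x b)                 ≡⟨ ∑-δ a (λ x → g x b) ⟩
  g a b                                           ∎
  where
  open ≡-Reasoning
  rearrange : ∀ z p q → z * (p * q) ≡ p * (q * z)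
  rearrange = solve-∀
  factor : ∀ x y → g x y * δ a b x y ≡ [ a == x ] * ([ b == y ] * g x y)
  factor x y = trans (cong (_*_ (g x y)) ([∧]≡[]*[] (a == x) (b == y)))
    (rearrange (g x y) [ a == x ] [ b == y ])

∑∑-net : ∀ {n} (a b : Fin n) (g : Fin n → Fin n → ℤ) →
  ∑[ x < n ] ∑[ y < n ] (g x y * net a b x y) ≡ g a b - g b a
∑∑-net {n} a b g = begin
  ∑[ x < n ] ∑[ y < n ] (g x y * net a b x y)
    ≡⟨ sum-cong-≗ (λ x → trans (sum-cong-≗ (λ y → distrib (g x y) (δ a b x y) (δ a b y x)))
                               (∑-distrib-- (λ y → g x y * δ a b x y) (λ y → g x y * δ a b y x))) ⟩
  ∑[ x < n ] (∑[ y < n ] (g x y * δ a b x y) - ∑[ y < n ] (g x y * δ a b y x))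
    ≡⟨ ∑-distrib-- (λ x → ∑[ y < n ] (g x y * δ a b x y)) (λ x → ∑[ y < n ] (g x y * δ a b y x)) ⟩
  ∑[ x < n ] ∑[ y < n ] (g x y * δ a b x y) - ∑[ x < n ] ∑[ y < n ] (g x y * δ a b y x)
    ≡⟨ cong (_-_ (∑[ x < n ] ∑[ y < n ] (g x y * δ a b x y)))
            (sum-cong-≗ (λ x → sum-cong-≗ (λ y → cong (_*_ (g x y)) (δ-flip a b y x)))) ⟩
  ∑[ x < n ] ∑[ y < n ] (g x y * δ a b x y) - ∑[ x < n ] ∑[ y < n ] (g x y * δ b a x y)
    ≡⟨ cong₂ _-_ (∑∑-δ a b g) (∑∑-δ b a g) ⟩
  g a b - g b a ∎
  where
  open ≡-Reasoning
  distrib : ∀ z p q → z * (p - q) ≡ z * p - z * q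
  distrib = solve-∀

-- Periodic sequences and their step sums

sumℕ-cong : ∀ k {f g : ℕ → ℤ} → (∀ i → i ℕ.< k → f i ≡ g i) → sumℕ k f ≡ sumℕ k g
sumℕ-cong zero    eq = refl
sumℕ-cong (suc k) eq = cong₂ _+_ (sumℕ-cong k (λ i i<k → eq i (ℕP.m<n⇒m<1+n i<k))) (eq k ℕP.≤-refl)

sumℕ-distrib-- : ∀ k (f g : ℕ → ℤ) → sumℕ k (λ i → f i - g i) ≡ sumℕ k f - sumℕ k g
sumℕ-distrib-- zero    f g = refl
sumℕ-distrib-- (suc k) f g =
  trans (cong (_+ (f k - g k)) (sumℕ-distrib-- k f g)) (regroup (sumℕ k f) (sumℕ k g) (f k) (g k))
  where
  regroup : ∀ a b c d → a - b + (c - d) ≡ a + c - (b + d)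
  regroup = solve-∀

sumℕ-*ˡ : ∀ k c (f : ℕ → ℤ) → sumℕ k (λ i → c * f i) ≡ c * sumℕ k f
sumℕ-*ˡ zero    c f = sym (ℤP.*-zeroʳ c)
sumℕ-*ˡ (suc k) c f =
  trans (cong (_+ c * f k) (sumℕ-*ˡ k c f)) (sym (ℤP.*-distribˡ-+ c (sumℕ k f) (f k)))

sumℕ-∑-comm : ∀ k {n} (f : ℕ → Fin n → ℤ) →
  sumℕ k (λ i → ∑[ j < n ] f i j) ≡ ∑[ j < n ] sumℕ k (λ i → f i j)
sumℕ-∑-comm zero    {n} f = sym (sum-replicate-zero n)
sumℕ-∑-comm (suc k) {n} f = trans (cong (_+ ∑[ j < n ] f k j) (sumℕ-∑-comm k f))
  (sym (∑-distrib-+ (λ j → sumℕ k (λ i → f i j)) (f k)))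

sumℕ-const : ∀ k → sumℕ k (λ _ → + 1) ≡ + k
sumℕ-const zero    = refl
sumℕ-const (suc k) = trans (cong (_+ + 1) (sumℕ-const k)) (cong +_ (ℕP.+-comm k 1))

sumℕ-head : ∀ k (f : ℕ → ℤ) → sumℕ (suc k) f ≡ f 0 + sumℕ k (f ∘ suc)
sumℕ-head zero    f = ℤP.+-comm (+ 0) (f 0)
sumℕ-head (suc k) f = trans (cong (_+ f (suc k)) (sumℕ-head k f)) (ℤP.+-assoc (f 0) _ _)

sumℕ-split : ∀ a b (f : ℕ → ℤ) → sumℕ (a ℕ.+ b) f ≡ sumℕ a f + sumℕ b (λ i → f (a ℕ.+ i))
sumℕ-split a zero    f = trans (cong (λ k → sumℕ k f) (ℕP.+-identityʳ a)) (sym (ℤP.+-identityʳ _))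
sumℕ-split a (suc b) f = begin
  sumℕ (a ℕ.+ suc b) f                                 ≡⟨ cong (λ k → sumℕ k f) (ℕP.+-suc a b) ⟩
  sumℕ (a ℕ.+ b) f + f (a ℕ.+ b)                       ≡⟨ cong (_+ f (a ℕ.+ b)) (sumℕ-split a b f) ⟩
  sumℕ a f + sumℕ b (λ i → f (a ℕ.+ i)) + f (a ℕ.+ b)  ≡⟨ ℤP.+-assoc (sumℕ a f) _ _ ⟩
  sumℕ a f + sumℕ (suc b) (λ i → f (a ℕ.+ i))          ∎
  where open ≡-Reasoning

sumℕ-even-odd : ∀ m (h : ℕ → ℤ) →
  sumℕ (2 ℕ.* m) h ≡ sumℕ m (λ i → h (2 ℕ.* i)) + sumℕ m (λ i → h (suc (2 ℕ.* i)))
sumℕ-even-odd zero    h = refl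
sumℕ-even-odd (suc m) h = begin
  sumℕ (2 ℕ.* suc m) h                                ≡⟨ cong (λ k → sumℕ k h) (ℕP.*-suc 2 m) ⟩
  sumℕ (2 ℕ.* m) h + h (2 ℕ.* m) + h (suc (2 ℕ.* m))
    ≡⟨ cong (λ s → s + h (2 ℕ.* m) + h (suc (2 ℕ.* m))) (sumℕ-even-odd m h) ⟩
  E + O + h (2 ℕ.* m) + h (suc (2 ℕ.* m))             ≡⟨ regroup E O (h (2 ℕ.* m)) (h (suc (2 ℕ.* m))) ⟩
  E + h (2 ℕ.* m) + (O + h (suc (2 ℕ.* m)))           ∎
  where
  open ≡-Reasoning
  E = sumℕ m (λ i → h (2 ℕ.* i))
  O = sumℕ m (λ i → h (suc (2 ℕ.* i)))
  regroup : ∀ a b c d → a + b + c + d ≡ a + c + (b + d)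
  regroup = solve-∀

Periodic : ∀ {A : Set} → ℕ → (ℕ → A) → Set
Periodic L h = ∀ x → h (L ℕ.+ x) ≡ h x

Periodic-suc : ∀ {A : Set} {L} {h : ℕ → A} → Periodic L h → Periodic L (h ∘ suc)
Periodic-suc {L = L} {h} per x = trans (cong h (sym (ℕP.+-suc L x))) (per (suc x))

sumℕ-rotate : ∀ L (h : ℕ → ℤ) → Periodic L h → sumℕ L (h ∘ suc) ≡ sumℕ L h
sumℕ-rotate L h per = +-cancelˡ (h 0) (sumℕ L (h ∘ suc)) (sumℕ L h) (begin
  h 0 + sumℕ L (h ∘ suc) ≡⟨ sym (sumℕ-head L h) ⟩
  sumℕ L h + h L         ≡⟨ cong (_+_ (sumℕ L h)) (trans (cong h (sym (ℕP.+-identityʳ L))) (per 0)) ⟩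
  sumℕ L h + h 0         ≡⟨ ℤP.+-comm (sumℕ L h) (h 0) ⟩
  h 0 + sumℕ L h         ∎)
  where open ≡-Reasoning

-- Modulo an odd period 2m+1, the doubles of 0, …, m are the even residues and the doubles of
-- m+1, …, 2m wrap around to the odd ones.
sumℕ-double : ∀ m (h : ℕ → ℤ) → Periodic (suc (2 ℕ.* m)) h →
  sumℕ (suc (2 ℕ.* m)) (λ i → h (2 ℕ.* i)) ≡ sumℕ (suc (2 ℕ.* m)) h
sumℕ-double m h per = begin
  sumℕ (suc (2 ℕ.* m)) (λ i → h (2 ℕ.* i))    ≡⟨ cong (λ k → sumℕ k (λ i → h (2 ℕ.* i))) (halves m) ⟩
  sumℕ (suc m ℕ.+ m) (λ i → h (2 ℕ.* i))      ≡⟨ sumℕ-split (suc m) m (λ i → h (2 ℕ.* i)) ⟩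
  E + h (2 ℕ.* m) + sumℕ m (λ i → h (2 ℕ.* (suc m ℕ.+ i)))
    ≡⟨ cong (_+_ (E + h (2 ℕ.* m))) (sumℕ-cong m (λ i _ → wrap i)) ⟩
  E + h (2 ℕ.* m) + O                         ≡⟨ regroup E (h (2 ℕ.* m)) O ⟩
  E + O + h (2 ℕ.* m)                         ≡⟨ cong (_+ h (2 ℕ.* m)) (sym (sumℕ-even-odd m h)) ⟩
  sumℕ (suc (2 ℕ.* m)) h                      ∎
  where
  open ≡-Reasoning
  E = sumℕ m (λ i → h (2 ℕ.* i))
  O = sumℕ m (λ i → h (suc (2 ℕ.* i)))
  halves : ∀ m → suc (2 ℕ.* m) ≡ suc m ℕ.+ m
  halves = NS.solve-∀
  doubled : ∀ m i → 2 ℕ.* (suc m ℕ.+ i) ≡ suc (2 ℕ.* m) ℕ.+ suc (2 ℕ.* i)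
  doubled = NS.solve-∀
  wrap : ∀ i → h (2 ℕ.* (suc m ℕ.+ i)) ≡ h (suc (2 ℕ.* i))
  wrap i = trans (cong h (doubled m i)) (per (suc (2 ℕ.* i)))
  regroup : ∀ a b c → a + b + c ≡ a + c + b
  regroup = solve-∀

stepSum : ∀ {n} → (Fin n → Fin n → ℤ) → ℕ → (ℕ → Fin n) → ℤ
stepSum φ L F = sumℕ L (λ j → φ (F j) (F (suc j)))

Periodic-step : ∀ {n} {A : Set} {L} {F : ℕ → Fin n} (ψ : Fin n → Fin n → A) →
  Periodic L F → Periodic L (λ j → ψ (F j) (F (suc j)))
Periodic-step ψ per x = cong₂ ψ (per x) (Periodic-suc per x)

stepSum-net : ∀ {n} (a b : Fin n) L F →
  stepSum (δ a b) L F - stepSum (δ b a) L F ≡ stepSum (net a b) L F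
stepSum-net a b L F = trans
  (cong (_-_ (stepSum (δ a b) L F)) (sumℕ-cong L (λ j _ → δ-flip b a (F j) (F (suc j)))))
  (sym (sumℕ-distrib-- L _ _))

∑-stepSum-source : ∀ {n} (u : Fin n) L F →
  ∑[ v < n ] stepSum (δ u v) L F ≡ sumℕ L (λ j → [ u == F j ])
∑-stepSum-source u L F = trans (sym (sumℕ-∑-comm L (λ j v → δ u v (F j) (F (suc j)))))
  (sumℕ-cong L (λ j _ → ∑-δ-source u (F j) (F (suc j))))

∑-stepSum-target : ∀ {n} (u : Fin n) L F → Periodic L F →
  ∑[ v < n ] stepSum (δ v u) L F ≡ sumℕ L (λ j → [ u == F j ])
∑-stepSum-target {n} u L F per = begin
  ∑[ v < n ] stepSum (δ v u) L F     ≡⟨ sym (sumℕ-∑-comm L (λ j v → δ v u (F j) (F (suc j)))) ⟩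
  sumℕ L (λ j → ∑[ v < n ] δ v u (F j) (F (suc j)))
    ≡⟨ sumℕ-cong L (λ j _ → ∑-δ-target u (F j) (F (suc j))) ⟩
  sumℕ L (λ j → [ u == F (suc j) ])  ≡⟨ sumℕ-rotate L _ (Periodic-step (λ x _ → [ u == x ]) per) ⟩
  sumℕ L (λ j → [ u == F j ])        ∎
  where open ≡-Reasoning

∑∑-stepSum : ∀ {n} L F → ∑[ u < n ] ∑[ v < n ] stepSum (δ u v) L F ≡ + L
∑∑-stepSum {n} L F = begin
  ∑[ u < n ] ∑[ v < n ] stepSum (δ u v) L F  ≡⟨ sum-cong-≗ (λ u → ∑-stepSum-source u L F) ⟩
  ∑[ u < n ] sumℕ L (λ j → [ u == F j ])     ≡⟨ sym (sumℕ-∑-comm L (λ j u → [ u == F j ])) ⟩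
  sumℕ L (λ j → ∑[ u < n ] [ u == F j ])     ≡⟨ sumℕ-cong L (λ j _ → ∑-δ-count (F j)) ⟩
  sumℕ L (λ _ → + 1)                         ≡⟨ sumℕ-const L ⟩
  + L                                        ∎
  where open ≡-Reasoning

mod-cong : ∀ L .{{_ : ℕ.NonZero L}} {x y} → x % L ≡ y % L → x mod L ≡ y mod L
mod-cong L {x} {y} eq = FP.toℕ-injective
  (trans (FP.toℕ-fromℕ< (DM.m%n<n x L)) (trans eq (sym (FP.toℕ-fromℕ< (DM.m%n<n y L)))))

suc-mod : ∀ L .{{_ : ℕ.NonZero L}} k → suc (toℕ (k mod L)) mod L ≡ suc k mod L
suc-mod L k = mod-cong L (begin
  suc (toℕ (k mod L)) % L    ≡⟨ cong (λ x → suc x % L) (FP.toℕ-fromℕ< (DM.m%n<n k L)) ⟩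
  (1 ℕ.+ k % L) % L          ≡⟨ DM.%-distribˡ-+ 1 (k % L) L ⟩
  (1 % L ℕ.+ k % L % L) % L  ≡⟨ cong (λ x → (1 % L ℕ.+ x) % L) (DM.m%n%n≡m%n k L) ⟩
  (1 % L ℕ.+ k % L) % L      ≡⟨ sym (DM.%-distribˡ-+ 1 k L) ⟩
  suc k % L                  ∎)
  where open ≡-Reasoning

Periodic-at : ∀ {n} L .{{_ : ℕ.NonZero L}} (f : Fin L → Fin n) → Periodic L (at L f)
Periodic-at L f x = cong f (mod-cong L (trans (cong (_% L) (ℕP.+-comm L x)) (DM.[m+n]%n≡m%n x L)))

sigmaVec≡stepSum-net : ∀ {n} m (f : Fin (suc (2 ℕ.* m)) → Fin n) a b →
  sigmaVec m f f a b ≡ stepSum (net a b) (suc (2 ℕ.* m)) (at (suc (2 ℕ.* m)) f)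
sigmaVec≡stepSum-net m f a b = begin
  sigmaVec m f f a b
    ≡⟨ sumℕ-distrib-- L (forward ∘ (2 ℕ.*_)) (backward ∘ suc ∘ (2 ℕ.*_)) ⟩
  sumℕ L (forward ∘ (2 ℕ.*_)) - sumℕ L (backward ∘ suc ∘ (2 ℕ.*_))
    ≡⟨ cong₂ _-_ (sumℕ-double m forward (Periodic-step (δ a b) per))
                 (sumℕ-double m (backward ∘ suc) (Periodic-suc backward-periodic)) ⟩
  sumℕ L forward - sumℕ L (backward ∘ suc)
    ≡⟨ cong (_-_ (sumℕ L forward)) (sumℕ-rotate L backward backward-periodic) ⟩
  sumℕ L forward - sumℕ L backward   ≡⟨ sym (sumℕ-distrib-- L forward backward) ⟩
  stepSum (net a b) L F              ∎
  where
  open ≡-Reasoning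
  L = suc (2 ℕ.* m)
  F = at L f
  per = Periodic-at L f
  forward backward : ℕ → ℤ
  forward  j = δ a b (F j) (F (suc j))
  backward j = δ a b (F (suc j)) (F j)
  backward-periodic : Periodic L backward
  backward-periodic = Periodic-step (λ x y → δ a b y x) per

-- From a homomorphism to a solution

adj-comm : ∀ {n} (H : Graph n) u v → adj H u v ≡ adj H v u
adj-comm H u v with adj H u v in uv | adj H v u in vu
... | true  | true  = refl
... | false | false = refl
... | true  | false = trans (sym (adj-sym H u v uv)) vu
... | false | true  = trans (sym uv) (adj-sym H v u vu)

InTheta-cong : ∀ {n} (H : Graph n) {z z' : ArcVec n} →
  (∀ a b → adj H a b ≡ true → z a b ≡ z' a b) → InTheta H z → InTheta H z'
InTheta-cong H z≡z' (c , c-supp , z≡∑c) =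
  c , c-supp , λ a b ab → trans (sym (z≡z' a b ab)) (z≡∑c a b ab)

δ-on-arcs : ∀ {n} (H : Graph n) a b x y → adj H x y ≡ true → [ adj H a b ] * δ a b x y ≡ δ a b x y
δ-on-arcs H a b x y xy with a == x in ax | b == y in by
... | true  | true rewrite ==⇒≡ ax | ==⇒≡ by | xy = refl
... | true  | false = ℤP.*-zeroʳ [ adj H a b ]
... | false | _     = ℤP.*-zeroʳ [ adj H a b ]

module HomToSolution {n} (H : Graph n) (m : ℕ) (f : Fin (suc (2 ℕ.* m)) → Fin n)
    (hom : IsHom H m f) where
  L = suc (2 ℕ.* m)
  F = at L f

  steps-are-arcs : ∀ j → adj H (F j) (F (suc j)) ≡ true
  steps-are-arcs j = subst (λ y → adj H (F j) y ≡ true) (cong f (suc-mod L j)) (hom (j mod L))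

  X : Fin n → Fin n → ℤ
  X a b = stepSum (δ a b) L F

  X-on-arcs : ∀ a b → [ adj H a b ] * X a b ≡ X a b
  X-on-arcs a b = trans (sym (sumℕ-*ˡ L [ adj H a b ] _))
    (sumℕ-cong L (λ j _ → δ-on-arcs H a b (F j) (F (suc j)) (steps-are-arcs j)))

  flow : ∀ u → ∑[ v < n ] ([ adj H u v ] * (X u v - X v u)) ≡ + 0
  flow u = begin
    ∑[ v < n ] ([ adj H u v ] * (X u v - X v u))  ≡⟨ sum-cong-≗ on-arcs ⟩
    ∑[ v < n ] (X u v - X v u)                    ≡⟨ ∑-distrib-- (X u) (λ v → X v u) ⟩
    ∑[ v < n ] X u v - ∑[ v < n ] X v u
      ≡⟨ cong₂ _-_ (∑-stepSum-source u L F) (∑-stepSum-target u L F (Periodic-at L f)) ⟩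
    visits - visits                               ≡⟨ ℤP.+-inverseʳ visits ⟩
    + 0                                           ∎
    where
    open ≡-Reasoning
    visits = sumℕ L (λ j → [ u == F j ])
    on-arcs : ∀ v → [ adj H u v ] * (X u v - X v u) ≡ X u v - X v u
    on-arcs v = trans (ℤP.*-distribˡ-+ [ adj H u v ] (X u v) (- X v u))
      (cong₂ _+_ (X-on-arcs u v) (trans (sym (ℤP.neg-distribʳ-* [ adj H u v ] (X v u)))
        (cong -_ (trans (cong (λ e → [ e ] * X v u) (adj-comm H u v)) (X-on-arcs v u)))))

  parity : ∑[ u < n ] ∑[ v < n ] ([ adj H u v ] * X u v) - + 2 * + m ≡ + 1
  parity = begin
    ∑[ u < n ] ∑[ v < n ] ([ adj H u v ] * X u v) - + 2 * + m
      ≡⟨ cong (_- + 2 * + m) (trans (sum-cong-≗ (sum-cong-≗ ∘ X-on-arcs)) (∑∑-stepSum L F)) ⟩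
    + L - + 2 * + m              ≡⟨ cong (_- + 2 * + m) (pos-suc-double m) ⟩
    + 1 + + 2 * + m - + 2 * + m  ≡⟨ cancel (+ m) ⟩
    + 1                          ∎
    where
    open ≡-Reasoning
    cancel : ∀ k → + 1 + + 2 * k - + 2 * k ≡ + 1
    cancel = solve-∀

  signature : SigmaZero H m f → InTheta H (λ u v → X u v - X v u)
  signature = InTheta-cong H (λ a b _ → trans (sigmaVec≡stepSum-net m f a b) (sym (stepSum-net a b L F)))

  solution : SigmaZero H m f → SignatureSystemSolvable H
  solution σ≡0 = X , + m
    , (λ u → trans (sumFin≡∑ n _) (flow u))
    , trans (cong (_- + 2 * + m) (sumFin²≡∑∑ n _)) parity
    , signature σ≡0

module _ {n} {H : Graph n} where

  _++ʷ_ : ∀ {u v w} → Walk H u v → Walk H v w → Walk H u w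
  here      ++ʷ q = q
  step uw p ++ʷ q = step uw (p ++ʷ q)

  reverseʷ : ∀ {u v} → Walk H u v → Walk H v u
  reverseʷ here                = here
  reverseʷ (step {u} {w} uw p) = reverseʷ p ++ʷ step (adj-sym H u w uw) here

  repeatʷ : ∀ {u} → ℕ → Walk H u u → Walk H u u
  repeatʷ zero    p = here
  repeatʷ (suc k) p = p ++ʷ repeatʷ k p

  concatʷ : ∀ {u} k → (Fin k → Walk H u u) → Walk H u u
  concatʷ zero    ps = here
  concatʷ (suc k) ps = ps F.zero ++ʷ concatʷ k (ps ∘ F.suc)

  lengthʷ : ∀ {u v} → Walk H u v → ℕ
  lengthʷ here       = 0
  lengthʷ (step _ p) = suc (lengthʷ p)

  -- Splitting on the index first makes vertexAt p 0 compute for every p; past the end of the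
  -- walk the last vertex is repeated.
  vertexAt : ∀ {u v} → Walk H u v → ℕ → Fin n
  vertexAt {u} p          zero    = u
  vertexAt {u} here       (suc j) = u
  vertexAt     (step _ p) (suc j) = vertexAt p j

  arcSum : (Fin n → Fin n → ℤ) → ∀ {u v} → Walk H u v → ℤ
  arcSum φ here               = + 0
  arcSum φ (step {u} {w} _ p) = φ u w + arcSum φ p

  arcSum-cong : ∀ {φ ψ : Fin n → Fin n → ℤ} → (∀ x y → φ x y ≡ ψ x y) →
    ∀ {u v} (p : Walk H u v) → arcSum φ p ≡ arcSum ψ p
  arcSum-cong φ≡ψ here               = refl
  arcSum-cong φ≡ψ (step {u} {w} _ p) = cong₂ _+_ (φ≡ψ u w) (arcSum-cong φ≡ψ p)

  arcSum-neg : ∀ φ {u v} (p : Walk H u v) → arcSum (λ x y → - φ x y) p ≡ - arcSum φ p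
  arcSum-neg φ here               = refl
  arcSum-neg φ (step {u} {w} _ p) =
    trans (cong (_+_ (- φ u w)) (arcSum-neg φ p)) (sym (ℤP.neg-distrib-+ (φ u w) (arcSum φ p)))

  arcSum-++ : ∀ φ {u v w} (p : Walk H u v) (q : Walk H v w) →
    arcSum φ (p ++ʷ q) ≡ arcSum φ p + arcSum φ q
  arcSum-++ φ here               q = sym (ℤP.+-identityˡ (arcSum φ q))
  arcSum-++ φ (step {u} {w} _ p) q =
    trans (cong (_+_ (φ u w)) (arcSum-++ φ p q)) (sym (ℤP.+-assoc (φ u w) (arcSum φ p) (arcSum φ q)))

  arcSum-reverse : ∀ φ {u v} (p : Walk H u v) → arcSum φ (reverseʷ p) ≡ arcSum (λ x y → φ y x) p
  arcSum-reverse φ here               = refl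
  arcSum-reverse φ (step {u} {w} _ p) = begin
    arcSum φ (reverseʷ p ++ʷ _)            ≡⟨ arcSum-++ φ (reverseʷ p) _ ⟩
    arcSum φ (reverseʷ p) + (φ w u + + 0)  ≡⟨ cong₂ _+_ (arcSum-reverse φ p) (ℤP.+-identityʳ (φ w u)) ⟩
    arcSum (λ x y → φ y x) p + φ w u       ≡⟨ ℤP.+-comm _ (φ w u) ⟩
    φ w u + arcSum (λ x y → φ y x) p       ∎
    where open ≡-Reasoning

  arcSum-repeat : ∀ φ {u} k (p : Walk H u u) → arcSum φ (repeatʷ k p) ≡ + k * arcSum φ p
  arcSum-repeat φ zero    p = refl
  arcSum-repeat φ (suc k) p = trans (arcSum-++ φ p (repeatʷ k p))
    (trans (cong (_+_ (arcSum φ p)) (arcSum-repeat φ k p)) (one-more (+ k) (arcSum φ p)))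
    where
    one-more : ∀ K s → s + K * s ≡ (+ 1 + K) * s
    one-more = solve-∀

  arcSum-concat : ∀ φ {u} k (ps : Fin k → Walk H u u) →
    arcSum φ (concatʷ k ps) ≡ ∑[ i < k ] arcSum φ (ps i)
  arcSum-concat φ zero    ps = refl
  arcSum-concat φ (suc k) ps = trans (arcSum-++ φ (ps F.zero) _)
    (cong (_+_ (arcSum φ (ps F.zero))) (arcSum-concat φ k (ps ∘ F.suc)))

  arcSum-length : ∀ {u v} (p : Walk H u v) → arcSum (λ _ _ → + 1) p ≡ + lengthʷ p
  arcSum-length here       = refl
  arcSum-length (step _ p) = trans (cong (_+_ (+ 1)) (arcSum-length p)) (sym (ℤP.pos-+ 1 (lengthʷ p)))

  arcSum≡stepSum : ∀ φ {u v} (p : Walk H u v) → arcSum φ p ≡ stepSum φ (lengthʷ p) (vertexAt p)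
  arcSum≡stepSum φ here               = refl
  arcSum≡stepSum φ (step {u} {w} _ p) =
    trans (cong (_+_ (φ u w)) (arcSum≡stepSum φ p)) (sym (sumℕ-head (lengthʷ p) _))

  vertexAt-end : ∀ {u v} (p : Walk H u v) → vertexAt p (lengthʷ p) ≡ v
  vertexAt-end here       = refl
  vertexAt-end (step _ p) = vertexAt-end p

  vertexAt-step : ∀ {u v} (p : Walk H u v) j → j ℕ.< lengthʷ p →
    adj H (vertexAt p j) (vertexAt p (suc j)) ≡ true
  vertexAt-step (step uw p) zero    _         = uw
  vertexAt-step (step _ p)  (suc j) (s≤s j<ℓ) = vertexAt-step p j j<ℓ

  closed-length≢1 : ∀ {u} (p : Walk H u u) → lengthʷ p ≢ 1
  closed-length≢1 {u} (step uu here) _ = contradiction (trans (sym uu) (irrfl H u)) λ ()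

-- From a solution to a homomorphism

module ClosedWalkToHom {n} {H : Graph n} {r} (W : Walk H r r) (m : ℕ)
    (odd : lengthʷ W ≡ suc (2 ℕ.* m)) where
  L = suc (2 ℕ.* m)

  f : Fin L → Fin n
  f i = vertexAt W (toℕ i)

  at-f : ∀ j → j ℕ.≤ L → at L f j ≡ vertexAt W j
  at-f j j≤L =
    trans (cong (vertexAt W) (FP.toℕ-fromℕ< (DM.m%n<n j L))) (reduce (ℕP.m≤n⇒m<n∨m≡n j≤L))
    where
    reduce : j ℕ.< L ⊎ j ≡ L → vertexAt W (j % L) ≡ vertexAt W j
    reduce (inj₁ j<L)  = cong (vertexAt W) (DM.m<n⇒m%n≡m j<L)
    reduce (inj₂ refl) = begin
      vertexAt W (L % L)      ≡⟨ cong (vertexAt W) (DM.n%n≡0 L) ⟩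
      r                       ≡⟨ sym (vertexAt-end W) ⟩
      vertexAt W (lengthʷ W)  ≡⟨ cong (vertexAt W) odd ⟩
      vertexAt W L            ∎
      where open ≡-Reasoning

  isHom : IsHom H m f
  isHom i = subst (λ y → adj H (f i) y ≡ true) (sym (at-f (suc (toℕ i)) (FP.toℕ<n i)))
    (vertexAt-step W (toℕ i) (subst (toℕ i ℕ.<_) (sym odd) (FP.toℕ<n i)))

  sigmaVec≡arcSum : ∀ a b → sigmaVec m f f a b ≡ arcSum (net a b) W
  sigmaVec≡arcSum a b = begin
    sigmaVec m f f a b                          ≡⟨ sigmaVec≡stepSum-net m f a b ⟩
    stepSum (net a b) L (at L f)
      ≡⟨ sumℕ-cong L (λ j j<L → cong₂ (net a b) (at-f j (ℕP.<⇒≤ j<L)) (at-f (suc j) j<L)) ⟩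
    stepSum (net a b) L (vertexAt W)            ≡⟨ cong (λ k → stepSum (net a b) k (vertexAt W)) (sym odd) ⟩
    stepSum (net a b) (lengthʷ W) (vertexAt W)  ≡⟨ sym (arcSum≡stepSum (net a b) W) ⟩
    arcSum (net a b) W                          ∎
    where open ≡-Reasoning

  m≥1 : m ≥ 1
  m≥1 = ℕP.n≢0⇒n>0 (λ m≡0 → closed-length≢1 W (trans odd (cong (λ k → suc (2 ℕ.* k)) m≡0)))

module RootedLoops {n} {H : Graph n} {r : Fin n} (P : ∀ u → Walk H r u) (k : Fin n → Fin n → ℕ) where

  loop : ∀ {u v} → adj H u v ≡ true → Walk H r r
  loop {u} {v} uv = P u ++ʷ step uv (reverseʷ (P v))

  loopSum : (Fin n → Fin n → ℤ) → Fin n → Fin n → ℤ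
  loopSum φ u v = arcSum φ (P u) + (φ u v + arcSum (λ x y → φ y x) (P v))

  arcSum-loop : ∀ φ {u v} (uv : adj H u v ≡ true) → arcSum φ (loop uv) ≡ loopSum φ u v
  arcSum-loop φ {u} {v} uv =
    trans (arcSum-++ φ (P u) _) (cong (λ s → arcSum φ (P u) + (φ u v + s)) (arcSum-reverse φ (P v)))

  -- The adjacency test is an explicit argument with its equation: with-abstracting over adj H u v
  -- in a lemma about the blocks would be ill-typed.
  loops : ∀ u v b → adj H u v ≡ b → Walk H r r
  loops u v true  uv = repeatʷ (k u v) (loop uv)
  loops u v false _  = here

  arcSum-loops : ∀ φ u v b (uv : adj H u v ≡ b) →
    arcSum φ (loops u v b uv) ≡ [ b ] * + k u v * loopSum φ u v
  arcSum-loops φ u v true  uv = trans (arcSum-repeat φ (k u v) (loop uv))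
    (cong₂ _*_ (sym (ℤP.*-identityˡ (+ k u v))) (arcSum-loop φ uv))
  arcSum-loops φ u v false _  = refl

  block : Fin n → Fin n → Walk H r r
  block u v = loops u v (adj H u v) refl

  W : Walk H r r
  W = concatʷ n (λ u → concatʷ n (block u))

  w : Fin n → Fin n → ℤ
  w u v = [ adj H u v ] * + k u v

  out : Fin n → ℤ
  out u = ∑[ v < n ] w u v

  arcSum-W : (∀ u → ∑[ v < n ] w v u ≡ out u) → ∀ φ →
    arcSum φ W ≡ ∑[ u < n ] (out u * (arcSum φ (P u) + arcSum (λ x y → φ y x) (P u)))
               + ∑[ u < n ] ∑[ v < n ] (w u v * φ u v)
  arcSum-W in≡out φ = begin
    arcSum φ W                                 ≡⟨ arcSum-concat φ n _ ⟩
    ∑[ u < n ] arcSum φ (concatʷ n (block u))  ≡⟨ sum-cong-≗ (λ u → arcSum-concat φ n (block u)) ⟩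
    ∑[ u < n ] ∑[ v < n ] arcSum φ (block u v)
      ≡⟨ sum-cong-≗ (λ u → sum-cong-≗ (λ v → trans (arcSum-loops φ u v _ refl) (expand u v))) ⟩
    ∑[ u < n ] ∑[ v < n ] (w u v * A u + w u v * φ u v + w u v * B v)
      ≡⟨ ∑∑-distrib₃ (λ u v → w u v * A u) (λ u v → w u v * φ u v) (λ u v → w u v * B v) ⟩
    ∑[ u < n ] ∑[ v < n ] (w u v * A u) + Sφ + ∑[ u < n ] ∑[ v < n ] (w u v * B v)
      ≡⟨ cong₂ (λ s t → s + Sφ + t) (sum-cong-≗ outflow)
               (trans (∑-comm (λ u v → w u v * B v)) (sum-cong-≗ inflow)) ⟩
    ∑[ u < n ] (out u * A u) + Sφ + ∑[ u < n ] (out u * B u)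
      ≡⟨ regroup (∑[ u < n ] (out u * A u)) Sφ (∑[ u < n ] (out u * B u)) ⟩
    ∑[ u < n ] (out u * A u) + ∑[ u < n ] (out u * B u) + Sφ
      ≡⟨ cong (_+ Sφ) (sym (∑-distrib-+ (λ u → out u * A u) (λ u → out u * B u))) ⟩
    ∑[ u < n ] (out u * A u + out u * B u) + Sφ
      ≡⟨ cong (_+ Sφ) (sum-cong-≗ (λ u → sym (ℤP.*-distribˡ-+ (out u) (A u) (B u)))) ⟩
    ∑[ u < n ] (out u * (A u + B u)) + Sφ      ∎
    where
    open ≡-Reasoning
    Sφ = ∑[ u < n ] ∑[ v < n ] (w u v * φ u v)
    A B : Fin n → ℤ
    A u = arcSum φ (P u)
    B u = arcSum (λ x y → φ y x) (P u)
    distrib₃ : ∀ x a p b → x * (a + (p + b)) ≡ x * a + x * p + x * b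
    distrib₃ = solve-∀
    expand : ∀ u v → w u v * loopSum φ u v ≡ w u v * A u + w u v * φ u v + w u v * B v
    expand u v = distrib₃ (w u v) (A u) (φ u v) (B v)
    outflow : ∀ u → ∑[ v < n ] (w u v * A u) ≡ out u * A u
    outflow u = sym (*-distribʳ-sum (A u) (w u))
    inflow : ∀ v → ∑[ u < n ] (w u v * B v) ≡ out v * B v
    inflow v = trans (sym (*-distribʳ-sum (B v) (λ u → w u v))) (cong (_* B v) (in≡out v))
    regroup : ∀ a p b → a + p + b ≡ a + b + p
    regroup = solve-∀

module SolutionToClosedWalk {n} (H : Graph n) (conn : Connected H) (r : Fin n)
    (X : Fin n → Fin n → ℤ) (N : ℤ) (sol : SignatureSolution H X N) where

  c : Fin n → Fin n → ℤ
  c u v = + (∣ X u v ∣ ℕ.+ ∣ X v u ∣)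

  X⁺ : Fin n → Fin n → ℤ
  X⁺ u v = X u v + (c u v + c u v)

  +∣X⁺∣≡X⁺ : ∀ u v → + ∣ X⁺ u v ∣ ≡ X⁺ u v
  +∣X⁺∣≡X⁺ u v =
    +∣i+s∣≡i+s (X u v) _ (ℕP.≤-trans (ℕP.m≤m+n ∣ X u v ∣ ∣ X v u ∣) (ℕP.m≤m+n _ _))

  X⁺-antisym : ∀ u v → X⁺ u v - X⁺ v u ≡ X u v - X v u
  X⁺-antisym u v =
    trans (cong (λ s → X⁺ u v - (X v u + (s + s))) (cong +_ (ℕP.+-comm ∣ X v u ∣ ∣ X u v ∣)))
          (cancel (X u v) (X v u) (c u v))
    where
    cancel : ∀ x y s → x + (s + s) - (y + (s + s)) ≡ x - y
    cancel = solve-∀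

  P : ∀ u → Walk H r u
  P = conn r

  open RootedLoops P (λ u v → ∣ X⁺ u v ∣) public

  w≡[adj]*X⁺ : ∀ u v → w u v ≡ [ adj H u v ] * X⁺ u v
  w≡[adj]*X⁺ u v = cong (_*_ [ adj H u v ]) (+∣X⁺∣≡X⁺ u v)

  w-antisym : ∀ u v → w u v - w v u ≡ [ adj H u v ] * (X u v - X v u)
  w-antisym u v = begin
    w u v - w v u                                    ≡⟨ cong₂ _-_ (w≡[adj]*X⁺ u v) (w≡[adj]*X⁺ v u) ⟩
    [ adj H u v ] * X⁺ u v - [ adj H v u ] * X⁺ v u
      ≡⟨ cong (λ e → [ adj H u v ] * X⁺ u v - [ e ] * X⁺ v u) (adj-comm H v u) ⟩
    [ adj H u v ] * X⁺ u v - [ adj H u v ] * X⁺ v u  ≡⟨ factor [ adj H u v ] (X⁺ u v) (X⁺ v u) ⟩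
    [ adj H u v ] * (X⁺ u v - X⁺ v u)                ≡⟨ cong (_*_ [ adj H u v ]) (X⁺-antisym u v) ⟩
    [ adj H u v ] * (X u v - X v u)                  ∎
    where
    open ≡-Reasoning
    factor : ∀ e x y → e * x - e * y ≡ e * (x - y)
    factor = solve-∀

  in≡out : ∀ u → ∑[ v < n ] w v u ≡ out u
  in≡out u = sym (ℤP.i-j≡0⇒i≡j _ _ (begin
    out u - ∑[ v < n ] w v u                          ≡⟨ sym (∑-distrib-- (w u) (λ v → w v u)) ⟩
    ∑[ v < n ] (w u v - w v u)                        ≡⟨ sum-cong-≗ (w-antisym u) ⟩
    ∑[ v < n ] ([ adj H u v ] * (X u v - X v u))      ≡⟨ sym (sumFin≡∑ n _) ⟩
    sumFin n (λ v → [ adj H u v ] * (X u v - X v u))  ≡⟨ proj₁ sol u ⟩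
    + 0                                               ∎))
    where open ≡-Reasoning

  arcSum-W-net : ∀ a b → adj H a b ≡ true → arcSum (net a b) W ≡ X a b - X b a
  arcSum-W-net a b ab = begin
    arcSum (net a b) W                ≡⟨ arcSum-W in≡out (net a b) ⟩
    ∑[ u < n ] (out u * (arcSum (net a b) (P u) + arcSum (λ x y → net a b y x) (P u)))
      + ∑[ u < n ] ∑[ v < n ] (w u v * net a b u v)
      ≡⟨ cong₂ _+_ (trans (sum-cong-≗ paths-cancel) (sum-replicate-zero n)) (∑∑-net a b w) ⟩
    + 0 + (w a b - w b a)             ≡⟨ ℤP.+-identityˡ _ ⟩
    w a b - w b a                     ≡⟨ w-antisym a b ⟩
    [ adj H a b ] * (X a b - X b a)   ≡⟨ cong (λ e → [ e ] * (X a b - X b a)) ab ⟩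
    + 1 * (X a b - X b a)             ≡⟨ ℤP.*-identityˡ _ ⟩
    X a b - X b a                     ∎
    where
    open ≡-Reasoning
    paths-cancel : ∀ u → out u * (arcSum (net a b) (P u) + arcSum (λ x y → net a b y x) (P u)) ≡ + 0
    paths-cancel u = begin
      out u * (arcSum (net a b) (P u) + arcSum (λ x y → net a b y x) (P u))
        ≡⟨ cong (λ s → out u * (arcSum (net a b) (P u) + s))
                (trans (arcSum-cong (net-flip a b) (P u)) (arcSum-neg (net a b) (P u))) ⟩
      out u * (arcSum (net a b) (P u) - arcSum (net a b) (P u))
        ≡⟨ cong (_*_ (out u)) (ℤP.+-inverseʳ (arcSum (net a b) (P u))) ⟩
      out u * + 0                     ≡⟨ ℤP.*-zeroʳ (out u) ⟩
      + 0                             ∎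

  length-odd : Σ ℕ λ m → lengthʷ W ≡ suc (2 ℕ.* m)
  length-odd = odd⇒suc-double (lengthʷ W) (∑[ u < n ] (out u * ℓ u) + N + C) (begin
    + lengthʷ W                                        ≡⟨ sym (arcSum-length W) ⟩
    arcSum (λ _ _ → + 1) W                             ≡⟨ arcSum-W in≡out (λ _ _ → + 1) ⟩
    ∑[ u < n ] (out u * (ℓ u + ℓ u)) + ∑[ u < n ] ∑[ v < n ] (w u v * + 1)
      ≡⟨ cong₂ _+_ paths-even total ⟩
    + 2 * ∑[ u < n ] (out u * ℓ u) + (+ 1 + + 2 * N + (C + C))
      ≡⟨ regroup (∑[ u < n ] (out u * ℓ u)) N C ⟩
    + 1 + + 2 * (∑[ u < n ] (out u * ℓ u) + N + C)    ∎)
    where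
    open ≡-Reasoning
    ℓ : Fin n → ℤ
    ℓ u = arcSum (λ _ _ → + 1) (P u)
    C = ∑[ u < n ] ∑[ v < n ] ([ adj H u v ] * c u v)
    T = sumFin n (λ u → sumFin n (λ v → [ adj H u v ] * X u v))
    double : ∀ o l → o * (l + l) ≡ + 2 * (o * l)
    double = solve-∀
    paths-even : ∑[ u < n ] (out u * (ℓ u + ℓ u)) ≡ + 2 * ∑[ u < n ] (out u * ℓ u)
    paths-even = trans (sum-cong-≗ (λ u → double (out u) (ℓ u)))
      (sym (*-distribˡ-sum (+ 2) (λ u → out u * ℓ u)))
    distrib : ∀ e x s → e * (x + (s + s)) ≡ e * x + e * s + e * s
    distrib = solve-∀
    split : ∀ u v → w u v * + 1 ≡ [ adj H u v ] * X u v + [ adj H u v ] * c u v + [ adj H u v ] * c u v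
    split u v = trans (ℤP.*-identityʳ (w u v))
      (trans (w≡[adj]*X⁺ u v) (distrib [ adj H u v ] (X u v) (c u v)))
    total : ∑[ u < n ] ∑[ v < n ] (w u v * + 1) ≡ + 1 + + 2 * N + (C + C)
    total = begin
      ∑[ u < n ] ∑[ v < n ] (w u v * + 1)
        ≡⟨ sum-cong-≗ (λ u → sum-cong-≗ (split u)) ⟩
      ∑[ u < n ] ∑[ v < n ] ([ adj H u v ] * X u v + [ adj H u v ] * c u v + [ adj H u v ] * c u v)
        ≡⟨ ∑∑-distrib₃ (λ u v → [ adj H u v ] * X u v) (λ u v → [ adj H u v ] * c u v)
                       (λ u v → [ adj H u v ] * c u v) ⟩
      ∑[ u < n ] ∑[ v < n ] ([ adj H u v ] * X u v) + C + C
        ≡⟨ cong (λ s → s + C + C) (sym (sumFin²≡∑∑ n (λ u v → [ adj H u v ] * X u v))) ⟩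
      T + C + C                      ≡⟨ cong (λ s → s + C + C) (parity⇒odd T N (proj₁ (proj₂ sol))) ⟩
      + 1 + + 2 * N + C + C          ≡⟨ ℤP.+-assoc (+ 1 + + 2 * N) C C ⟩
      + 1 + + 2 * N + (C + C)        ∎
    regroup : ∀ S N C → + 2 * S + (+ 1 + + 2 * N + (C + C)) ≡ + 1 + + 2 * (S + N + C)
    regroup = solve-∀

solvable⇒oddHom : ∀ {n} (H : Graph n) → Connected H → SignatureSystemSolvable H →
  Σ ℕ (λ m → (m ≥ 1) × Σ (Fin (suc (2 ℕ.* m)) → Fin n) (λ f → IsHom H m f × SigmaZero H m f))
solvable⇒oddHom {zero} H conn (X , N , (_ , parity , _)) with odd⇒suc-double 0 N (parity⇒odd _ N parity)
... | _ , ()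
solvable⇒oddHom {suc n} H conn (X , N , sol@(_ , _ , X-Xᵀ∈θ)) = m , m≥1 , f , isHom , σ≡0
  where
  open SolutionToClosedWalk H conn F.zero X N sol
  m = proj₁ length-odd
  open ClosedWalkToHom W m (proj₂ length-odd)
  σ≡0 : SigmaZero H m f
  σ≡0 = InTheta-cong H (λ a b ab → trans (sym (arcSum-W-net a b ab)) (sym (sigmaVec≡arcSum a b))) X-Xᵀ∈θ

proposition8 : ∀ {n} (H : Graph n) → Connected H →
  SignatureSystemSolvable H ⇔
    Σ ℕ (λ m → (m ≥ 1) × Σ (Fin (suc (2 ℕ.* m)) → Fin n) (λ f → IsHom H m f × SigmaZero H m f))
proposition8 H conn = mk⇔ (solvable⇒oddHom H conn)
  (λ (m , _ , f , hom , σ≡0) → HomToSolution.solution H m f hom σ≡0)
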